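{- Let $x$ and $n$ be positive integers. Then (i) $\prod_{k=0}^{n-1}\bigl(1+\frac{1}{3(x+k)}\bigr)\le 1+\frac{n}{3x}$; (ii) if $x\ge n$, then $\prod_{k=0}^{n-1}\bigl(1+\frac{1}{3(x-k)}\bigr)\ge 1+\frac{n}{3x}$; (iii) if $x\ge n\ge2$, then $\prod_{k=0}^{n-1}\bigl(1+\frac{1}{3(x-k)}\bigr)>\frac{3x}{3x-n}$. -}

module Defs where

open import Data.Nat using (ℕ; zero; suc)
open import Data.Integer using (+_)
open import Data.Rational using (ℚ; _/_; _*_; 0ℚ; 1ℚ)

-- The rational number 1/d for a natural number d.  Convention: value 0 at
-- d = 0; in the statement it is only ever applied to positive d.
recip : ℕ → ℚ
recip zero    = 0ℚ
recip (suc m) = + 1 / suc m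

prod : ℕ → (ℕ → ℚ) → ℚ
prod zero    f = 1ℚ
prod (suc n) f = prod n f * f n

-- Write φ(t) = 1 + 1/t.  Both comparison functions telescope into factors
-- of the same shape:
--   (X+n+1)/X = (X+n)/X · φ(X+n)   and   X/(X-n-1) = X/(X-n) · φ(X-n-1),
-- and φ is antitone.  So each bound reduces to comparing denominators:
-- 3(x+k) ≥ X+k for (i), 3(x-k) ≤ X+k for (ii), 3(x-k) ≤ X-k-1 for (iii).
--
-- Only (iii)
-- needs an explicit base case, n = 2, checked by a polynomial identity.
module Submission where

open import Defs
open import Data.Nat using (ℕ; _∸_; _≤_) renaming (_+_ to _+ℕ_; _*_ to _*ℕ_)
open import Data.Integer using (+_)
open import Data.Rational using (ℚ; _+_; _*_; _/_; 1ℚ) renaming (_≤_ to _≤ℚ_; _<_ to _<ℚ_)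
open import Data.Product using (_×_; _,_)

open import Data.Nat using (zero; suc; _<_; _≤′_; ≤′-refl; ≤′-step; s≤s; z≤n; z<s; NonZero; >-nonZero⁻¹)
import Data.Nat.Properties as ℕ
open import Data.Nat.Tactic.RingSolver using (solve-∀)
import Data.Integer as ℤ
import Data.Integer.Properties as ℤ
open import Data.Rational using (toℚᵘ; Positive; NonNegative)
open import Data.Rational.Properties
  using ( toℚᵘ-fromℚᵘ; toℚᵘ-cancel-≤; toℚᵘ-cancel-<; toℚᵘ-injective; toℚᵘ-homo-*; toℚᵘ-homo-+
        ; ≤-antisym; ≤-trans; ≤-<-trans; +-monoʳ-≤; *-monoʳ-≤-nonNeg; *-monoˡ-≤-nonNeg; *-monoˡ-<-pos
        ; *-identityˡ; *-assoc; normalize-nonNeg; pos+nonNeg⇒pos; pos⇒nonNeg; nonNeg*nonNeg⇒nonNeg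
        ; module ≤-Reasoning )
import Data.Rational.Unnormalised as ℚᵘ
import Data.Rational.Unnormalised.Properties as ℚᵘ
open import Function using (_∘_)
open import Relation.Binary.PropositionalEquality

-- The rational a/b; note that recip (suc m) and + n / 1 are literally
-- frac 1 (suc m) and frac n 1.
frac : (a b : ℕ) → .{{NonZero b}} → ℚ
frac a b = + a / b

toℚᵘ-frac : ∀ a b .{{_ : NonZero b}} → toℚᵘ (frac a b) ℚᵘ.≃ (+ a ℚᵘ./ b)
toℚᵘ-frac a (suc b) = toℚᵘ-fromℚᵘ (+ a ℚᵘ./ suc b)

frac-≤ : ∀ a b c d .{{_ : NonZero b}} .{{_ : NonZero d}} →
         a *ℕ d ≤ c *ℕ b → frac a b ≤ℚ frac c d
frac-≤ a b@(suc _) c d@(suc _) ad≤cb = toℚᵘ-cancel-≤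
  (ℚᵘ.≤-respˡ-≃ (ℚᵘ.≃-sym (toℚᵘ-frac a b)) (ℚᵘ.≤-respʳ-≃ (ℚᵘ.≃-sym (toℚᵘ-frac c d))
    (ℚᵘ.*≤* (subst₂ ℤ._≤_ (ℤ.pos-* a d) (ℤ.pos-* c b) (ℤ.+≤+ ad≤cb)))))

frac-< : ∀ a b c d .{{_ : NonZero b}} .{{_ : NonZero d}} →
         a *ℕ d < c *ℕ b → frac a b <ℚ frac c d
frac-< a b@(suc _) c d@(suc _) ad<cb = toℚᵘ-cancel-<
  (ℚᵘ.<-respˡ-≃ (ℚᵘ.≃-sym (toℚᵘ-frac a b)) (ℚᵘ.<-respʳ-≃ (ℚᵘ.≃-sym (toℚᵘ-frac c d))
    (ℚᵘ.*<* (subst₂ ℤ._<_ (ℤ.pos-* a d) (ℤ.pos-* c b) (ℤ.+<+ ad<cb)))))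

frac-≡ : ∀ a b c d .{{_ : NonZero b}} .{{_ : NonZero d}} →
         a *ℕ d ≡ c *ℕ b → frac a b ≡ frac c d
frac-≡ a b c d ad≡cb = ≤-antisym (frac-≤ a b c d (ℕ.≤-reflexive ad≡cb))
                                 (frac-≤ c d a b (ℕ.≤-reflexive (sym ad≡cb)))

frac-* : ∀ a b c d .{{_ : NonZero b}} .{{_ : NonZero d}} →
         frac a b * frac c d ≡ frac (a *ℕ c) (b *ℕ d) {{ℕ.m*n≢0 b d}}
frac-* a b@(suc _) c d@(suc _) = toℚᵘ-injective (begin
  toℚᵘ (frac a b * frac c d)             ≈⟨ toℚᵘ-homo-* (frac a b) (frac c d) ⟩
  toℚᵘ (frac a b) ℚᵘ.* toℚᵘ (frac c d)   ≈⟨ ℚᵘ.*-cong (toℚᵘ-frac a b) (toℚᵘ-frac c d) ⟩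
  (+ a ℤ.* + c) ℚᵘ./ (b *ℕ d)            ≡⟨ cong (ℚᵘ._/ (b *ℕ d)) (ℤ.pos-* a c) ⟨
  + (a *ℕ c) ℚᵘ./ (b *ℕ d)               ≈⟨ toℚᵘ-frac (a *ℕ c) (b *ℕ d) ⟨
  toℚᵘ (frac (a *ℕ c) (b *ℕ d))          ∎)
  where open ℚᵘ.≃-Reasoning

frac-+ : ∀ a b c d .{{_ : NonZero b}} .{{_ : NonZero d}} →
         frac a b + frac c d ≡ frac (a *ℕ d +ℕ c *ℕ b) (b *ℕ d) {{ℕ.m*n≢0 b d}}
frac-+ a b@(suc _) c d@(suc _) = toℚᵘ-injective (begin
  toℚᵘ (frac a b + frac c d)                    ≈⟨ toℚᵘ-homo-+ (frac a b) (frac c d) ⟩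
  toℚᵘ (frac a b) ℚᵘ.+ toℚᵘ (frac c d)          ≈⟨ ℚᵘ.+-cong (toℚᵘ-frac a b) (toℚᵘ-frac c d) ⟩
  (+ a ℤ.* + d ℤ.+ + c ℤ.* + b) ℚᵘ./ (b *ℕ d)   ≡⟨ cong (ℚᵘ._/ (b *ℕ d)) numerator ⟩
  + (a *ℕ d +ℕ c *ℕ b) ℚᵘ./ (b *ℕ d)            ≈⟨ toℚᵘ-frac (a *ℕ d +ℕ c *ℕ b) (b *ℕ d) ⟨
  toℚᵘ (frac (a *ℕ d +ℕ c *ℕ b) (b *ℕ d))       ∎)
  where
  open ℚᵘ.≃-Reasoning
  numerator : + a ℤ.* + d ℤ.+ + c ℤ.* + b ≡ + (a *ℕ d +ℕ c *ℕ b)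
  numerator = trans (cong₂ ℤ._+_ (sym (ℤ.pos-* a d)) (sym (ℤ.pos-* c b)))
                    (sym (ℤ.pos-+ (a *ℕ d) (c *ℕ b)))

frac-nonNeg : ∀ a b .{{_ : NonZero b}} → NonNegative (frac a b)
frac-nonNeg a b = normalize-nonNeg a b

one≤frac : ∀ a b .{{_ : NonZero b}} → b ≤ a → 1ℚ ≤ℚ frac a b
one≤frac a b b≤a = frac-≤ 1 1 a b (subst₂ _≤_ (sym (ℕ.*-identityˡ b)) (sym (ℕ.*-identityʳ a)) b≤a)

frac≤one : ∀ a b .{{_ : NonZero b}} → a ≤ b → frac a b ≤ℚ 1ℚ
frac≤one a b a≤b = frac-≤ a b 1 1 (subst₂ _≤_ (sym (ℕ.*-identityʳ a)) (sym (ℕ.*-identityˡ b)) a≤b)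

scaled-recip : ∀ c e .{{_ : NonZero e}} → frac c 1 * recip e ≡ frac c e
scaled-recip c e@(suc _) = trans (frac-* c 1 1 e) (frac-≡ (c *ℕ 1) (1 *ℕ e) c e (identity c e))
  where
  identity : ∀ c e → c *ℕ 1 *ℕ e ≡ c *ℕ (1 *ℕ e)
  identity = solve-∀

one-plus-multiple : ∀ n X .{{_ : NonZero X}} → 1ℚ + frac n 1 * recip X ≡ frac (X +ℕ n) X
one-plus-multiple n X@(suc _) = begin
  1ℚ + frac n 1 * recip X           ≡⟨ cong (λ q → 1ℚ + q) (scaled-recip n X) ⟩
  frac 1 1 + frac n X               ≡⟨ frac-+ 1 1 n X ⟩
  frac (1 *ℕ X +ℕ n *ℕ 1) (1 *ℕ X)  ≡⟨ frac-≡ (1 *ℕ X +ℕ n *ℕ 1) (1 *ℕ X) (X +ℕ n) X (identity n X) ⟩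
  frac (X +ℕ n) X                   ∎
  where
  open ≡-Reasoning
  identity : ∀ n X → (1 *ℕ X +ℕ n *ℕ 1) *ℕ X ≡ (X +ℕ n) *ℕ (1 *ℕ X)
  identity = solve-∀

factor : ℕ → ℚ
factor t = 1ℚ + recip t

recip-nonNeg : ∀ t → NonNegative (recip t)
recip-nonNeg zero    = _
recip-nonNeg (suc t) = normalize-nonNeg 1 (suc t)

factor-pos : ∀ t → Positive (factor t)
factor-pos t = pos+nonNeg⇒pos 1ℚ (recip t) {{recip-nonNeg t}}

factor-nonNeg : ∀ t → NonNegative (factor t)
factor-nonNeg t = pos⇒nonNeg (factor t) {{factor-pos t}}

factor-frac : ∀ t → factor (suc t) ≡ frac (suc (suc t)) (suc t)
factor-frac t = trans (frac-+ 1 1 1 (suc t))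
                      (frac-≡ (1 *ℕ suc t +ℕ 1 *ℕ 1) (1 *ℕ suc t) (suc (suc t)) (suc t) (identity (suc t)))
  where
  identity : ∀ e → (1 *ℕ e +ℕ 1 *ℕ 1) *ℕ e ≡ suc e *ℕ (1 *ℕ e)
  identity = solve-∀

-- Larger (positive) denominators give smaller factors: this is what turns
-- every comparison of products into a comparison of denominators.
recip-antitone : ∀ {a b} → 1 ≤ a → a ≤ b → recip b ≤ℚ recip a
recip-antitone {suc a} {suc b} _ a≤b = frac-≤ 1 (suc b) 1 (suc a) (ℕ.*-monoʳ-≤ 1 a≤b)

factor-antitone : ∀ {a b} → 1 ≤ a → a ≤ b → factor b ≤ℚ factor a
factor-antitone 1≤a a≤b = +-monoʳ-≤ 1ℚ (recip-antitone 1≤a a≤b)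

frac-split : ∀ m b .{{_ : NonZero b}} → 1 ≤ m → frac (suc m) b ≡ frac m b * factor m
frac-split m@(suc t) b@(suc _) _ = sym (begin
  frac m b * factor m         ≡⟨ cong (frac m b *_) (factor-frac t) ⟩
  frac m b * frac (suc m) m   ≡⟨ frac-* m b (suc m) m ⟩
  frac (m *ℕ suc m) (b *ℕ m)  ≡⟨ frac-≡ (m *ℕ suc m) (b *ℕ m) (suc m) b (identity m b) ⟩
  frac (suc m) b              ∎)
  where
  open ≡-Reasoning
  identity : ∀ m b → m *ℕ suc m *ℕ b ≡ suc m *ℕ (b *ℕ m)
  identity = solve-∀

recip-split : ∀ e → 1 ≤ e → recip e ≡ recip (suc e) * factor e
recip-split e@(suc t) _ = sym (begin
  recip (suc e) * factor e         ≡⟨ cong (recip (suc e) *_) (factor-frac t) ⟩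
  frac 1 (suc e) * frac (suc e) e  ≡⟨ frac-* 1 (suc e) (suc e) e ⟩
  frac (1 *ℕ suc e) (suc e *ℕ e)   ≡⟨ frac-≡ (1 *ℕ suc e) (suc e *ℕ e) 1 e (identity e) ⟩
  frac 1 e                         ∎)
  where
  open ≡-Reasoning
  identity : ∀ e → 1 *ℕ suc e *ℕ e ≡ 1 *ℕ (suc e *ℕ e)
  identity = solve-∀

prod-upper : (f g : ℕ → ℚ) → (∀ k → NonNegative (f k)) →
             1ℚ ≤ℚ g 0 → (∀ k → g k * f k ≤ℚ g (suc k)) →
             ∀ n → prod n f ≤ℚ g n
prod-upper f g f≥0 base step zero    = base
prod-upper f g f≥0 base step (suc n) =
  ≤-trans (*-monoʳ-≤-nonNeg (f n) {{f≥0 n}} (prod-upper f g f≥0 base step n)) (step n)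

prod-lower : (f g : ℕ → ℚ) (N : ℕ) → (∀ k → NonNegative (f k)) →
             g 0 ≤ℚ 1ℚ → (∀ k → k < N → g (suc k) ≤ℚ g k * f k) →
             ∀ n → n ≤ N → g n ≤ℚ prod n f
prod-lower f g N f≥0 base step zero    _   = base
prod-lower f g N f≥0 base step (suc n) n<N =
  ≤-trans (step n n<N) (*-monoʳ-≤-nonNeg (f n) {{f≥0 n}} (prod-lower f g N f≥0 base step n (ℕ.<⇒≤ n<N)))

prod-strict-lower : (f g : ℕ → ℚ) (m N : ℕ) → (∀ k → Positive (f k)) →
                    g m <ℚ prod m f → (∀ k → m ≤ k → k < N → g (suc k) ≤ℚ g k * f k) →
                    ∀ n → m ≤ n → n ≤ N → g n <ℚ prod n f
prod-strict-lower f g m N f>0 base step n m≤n = go n (ℕ.≤⇒≤′ m≤n)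
  where
  go : ∀ n → m ≤′ n → n ≤ N → g n <ℚ prod n f
  go n       ≤′-refl        _   = base
  go (suc n) (≤′-step m≤′n) n<N =
    ≤-<-trans (step n (ℕ.≤′⇒≤ m≤′n) n<N) (*-monoˡ-<-pos (f n) {{f>0 n}} (go n m≤′n (ℕ.<⇒≤ n<N)))

1≤X+k : ∀ X .{{_ : NonZero X}} k → 1 ≤ X +ℕ k
1≤X+k X k = ℕ.≤-trans (>-nonZero⁻¹ X) (ℕ.m≤m+n X k)

linear-telescope : ∀ X .{{_ : NonZero X}} k → frac (X +ℕ suc k) X ≡ frac (X +ℕ k) X * factor (X +ℕ k)
linear-telescope X k = trans (cong (λ a → frac a X) (ℕ.+-suc X k)) (frac-split (X +ℕ k) X (1≤X+k X k))

product-upper-bound : ∀ X .{{_ : NonZero X}} (d : ℕ → ℕ) → (∀ k → X +ℕ k ≤ d k) →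
                      ∀ n → prod n (factor ∘ d) ≤ℚ frac (X +ℕ n) X
product-upper-bound X d d≥ = prod-upper (factor ∘ d) (λ n → frac (X +ℕ n) X)
  (factor-nonNeg ∘ d) (one≤frac (X +ℕ 0) X (ℕ.m≤m+n X 0)) step
  where
  step : ∀ k → frac (X +ℕ k) X * factor (d k) ≤ℚ frac (X +ℕ suc k) X
  step k = begin
    frac (X +ℕ k) X * factor (d k)     ≤⟨ *-monoˡ-≤-nonNeg (frac (X +ℕ k) X) {{frac-nonNeg (X +ℕ k) X}}
                                            (factor-antitone (1≤X+k X k) (d≥ k)) ⟩
    frac (X +ℕ k) X * factor (X +ℕ k)  ≡⟨ linear-telescope X k ⟨
    frac (X +ℕ suc k) X                ∎
    where open ≤-Reasoning

product-lower-bound : ∀ X .{{_ : NonZero X}} (d : ℕ → ℕ) N →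
                      (∀ k → k < N → 1 ≤ d k) → (∀ k → k < N → d k ≤ X +ℕ k) →
                      ∀ n → n ≤ N → frac (X +ℕ n) X ≤ℚ prod n (factor ∘ d)
product-lower-bound X d N d≥1 d≤ = prod-lower (factor ∘ d) (λ n → frac (X +ℕ n) X) N
  (factor-nonNeg ∘ d) (frac≤one (X +ℕ 0) X (ℕ.≤-reflexive (ℕ.+-identityʳ X))) step
  where
  step : ∀ k → k < N → frac (X +ℕ suc k) X ≤ℚ frac (X +ℕ k) X * factor (d k)
  step k k<N = begin
    frac (X +ℕ suc k) X                ≡⟨ linear-telescope X k ⟩
    frac (X +ℕ k) X * factor (X +ℕ k)  ≤⟨ *-monoˡ-≤-nonNeg (frac (X +ℕ k) X) {{frac-nonNeg (X +ℕ k) X}}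
                                            (factor-antitone (d≥1 k k<N) (d≤ k k<N)) ⟩
    frac (X +ℕ k) X * factor (d k)     ∎
    where open ≤-Reasoning

m∸n≡suc[m∸suc[n]] : ∀ m n → n < m → m ∸ n ≡ suc (m ∸ suc n)
m∸n≡suc[m∸suc[n]] (suc m) zero    _         = refl
m∸n≡suc[m∸suc[n]] (suc m) (suc n) (s≤s n<m) = m∸n≡suc[m∸suc[n]] m n n<m

reciprocal-telescope : ∀ c X k → 1 ≤ X ∸ suc k →
  frac c 1 * recip (X ∸ suc k) ≡ (frac c 1 * recip (X ∸ k)) * factor (X ∸ suc k)
reciprocal-telescope c X k 1≤E = begin
  frac c 1 * recip E                     ≡⟨ cong (frac c 1 *_) (recip-split E 1≤E) ⟩
  frac c 1 * (recip (suc E) * factor E)  ≡⟨ *-assoc (frac c 1) (recip (suc E)) (factor E) ⟨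
  (frac c 1 * recip (suc E)) * factor E  ≡⟨ cong (λ e → (frac c 1 * recip e) * factor E) X∸k≡1+E ⟨
  (frac c 1 * recip (X ∸ k)) * factor E  ∎
  where
  open ≡-Reasoning
  E = X ∸ suc k
  X∸k≡1+E : X ∸ k ≡ suc E
  X∸k≡1+E = m∸n≡suc[m∸suc[n]] X k (ℕ.<⇒≤ (ℕ.m∸n≢0⇒n<m (ℕ.m<n⇒n≢0 1≤E)))

reciprocal-lower-bound : ∀ c X (d : ℕ → ℕ) m N →
  frac c 1 * recip (X ∸ m) <ℚ prod m (factor ∘ d) →
  (∀ k → m ≤ k → k < N → 1 ≤ d k) → (∀ k → m ≤ k → k < N → d k ≤ X ∸ suc k) →
  ∀ n → m ≤ n → n ≤ N → frac c 1 * recip (X ∸ n) <ℚ prod n (factor ∘ d)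
reciprocal-lower-bound c X d m N base d≥1 d≤ =
  prod-strict-lower (factor ∘ d) (λ n → frac c 1 * recip (X ∸ n)) m N (factor-pos ∘ d) base step
  where
  step : ∀ k → m ≤ k → k < N → frac c 1 * recip (X ∸ suc k) ≤ℚ (frac c 1 * recip (X ∸ k)) * factor (d k)
  step k m≤k k<N = begin
    frac c 1 * recip (X ∸ suc k)                     ≡⟨ reciprocal-telescope c X k 1≤E ⟩
    (frac c 1 * recip (X ∸ k)) * factor (X ∸ suc k)  ≤⟨ *-monoˡ-≤-nonNeg (frac c 1 * recip (X ∸ k)) {{g≥0}}
                                                          (factor-antitone (d≥1 k m≤k k<N) (d≤ k m≤k k<N)) ⟩
    (frac c 1 * recip (X ∸ k)) * factor (d k)        ∎
    where
    open ≤-Reasoning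
    1≤E : 1 ≤ X ∸ suc k
    1≤E = ℕ.≤-trans (d≥1 k m≤k k<N) (d≤ k m≤k k<N)
    g≥0 : NonNegative (frac c 1 * recip (X ∸ k))
    g≥0 = nonNeg*nonNeg⇒nonNeg (frac c 1) {{frac-nonNeg c 1}} (recip (X ∸ k)) {{recip-nonNeg (X ∸ k)}}

-- The base case of (iii) with X = w + 3:  (w+3)/(w+1) < φ(w+3) · φ(w),
-- i.e. (w+3)² w < (w+4)(w+1)², the two sides differing by exactly 4.
two-term-bound : ∀ w → 1 ≤ w → frac (3 +ℕ w) 1 * recip (suc w) <ℚ (1ℚ * factor (3 +ℕ w)) * factor w
two-term-bound w@(suc v) _ = begin-strict
  frac (3 +ℕ w) 1 * recip (suc w)                    ≡⟨ scaled-recip (3 +ℕ w) (suc w) ⟩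
  frac (3 +ℕ w) (suc w)                              <⟨ frac-< (3 +ℕ w) (suc w) ((5 +ℕ v) *ℕ (2 +ℕ v))
                                                             ((4 +ℕ v) *ℕ (1 +ℕ v)) cross-multiplied ⟩
  frac ((5 +ℕ v) *ℕ (2 +ℕ v)) ((4 +ℕ v) *ℕ (1 +ℕ v))  ≡⟨ frac-* (5 +ℕ v) (4 +ℕ v) (2 +ℕ v) (1 +ℕ v) ⟨
  frac (5 +ℕ v) (4 +ℕ v) * frac (2 +ℕ v) (1 +ℕ v)    ≡⟨ cong₂ _*_ (factor-frac (3 +ℕ v)) (factor-frac v) ⟨
  factor (3 +ℕ w) * factor w                         ≡⟨ cong (_* factor w) (*-identityˡ (factor (3 +ℕ w))) ⟨
  (1ℚ * factor (3 +ℕ w)) * factor w                  ∎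
  where
  open ≤-Reasoning
  identity : ∀ v → (5 +ℕ v) *ℕ (2 +ℕ v) *ℕ (2 +ℕ v) ≡ (4 +ℕ v) *ℕ ((4 +ℕ v) *ℕ (1 +ℕ v)) +ℕ 4
  identity = solve-∀
  cross-multiplied : (4 +ℕ v) *ℕ ((4 +ℕ v) *ℕ (1 +ℕ v)) < (5 +ℕ v) *ℕ (2 +ℕ v) *ℕ (2 +ℕ v)
  cross-multiplied = subst ((4 +ℕ v) *ℕ ((4 +ℕ v) *ℕ (1 +ℕ v)) <_) (sym (identity v)) (ℕ.m<m+n _ z<s)

rising-denominator : ∀ x k → 3 *ℕ x +ℕ k ≤ 3 *ℕ (x +ℕ k)
rising-denominator x k =
  subst (3 *ℕ x +ℕ k ≤_) (sym (ℕ.*-distribˡ-+ 3 x k)) (ℕ.+-monoʳ-≤ (3 *ℕ x) (ℕ.m≤n*m k 3))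

falling-denominator-pos : ∀ x k → k < x → 1 ≤ 3 *ℕ (x ∸ k)
falling-denominator-pos x k k<x = ℕ.≤-trans (ℕ.m<n⇒0<n∸m k<x) (ℕ.m≤n*m (x ∸ k) 3)

falling-denominator-≤ : ∀ x k → 3 *ℕ (x ∸ k) ≤ 3 *ℕ x +ℕ k
falling-denominator-≤ x k = ℕ.≤-trans (ℕ.*-monoʳ-≤ 3 (ℕ.m∸n≤m x k)) (ℕ.m≤m+n (3 *ℕ x) k)

-- 3(x-k) ≤ 3x-k-1 for k ≥ 1, since 3k ≥ k+1.
falling-denominator-gap : ∀ x k → 1 ≤ k → 3 *ℕ (x ∸ k) ≤ 3 *ℕ x ∸ suc k
falling-denominator-gap x k@(suc _) _ =
  subst (_≤ 3 *ℕ x ∸ suc k) (sym (ℕ.*-distribˡ-∸ 3 x k)) (ℕ.∸-monoʳ-≤ (3 *ℕ x) k<3k)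
  where
  k<3k : k < 3 *ℕ k
  k<3k = subst (k <_) (ℕ.*-comm k 3) (ℕ.m<m*n k 3 (s≤s (s≤s z≤n)))

-- (iii) at n = 2: with x = y + 2 we have 3x = w + 3 for w = 3(y+1).
two-factor-base : ∀ x → 2 ≤ x →
  frac (3 *ℕ x) 1 * recip (3 *ℕ x ∸ 2) <ℚ prod 2 (λ k → factor (3 *ℕ (x ∸ k)))
two-factor-base (suc (suc y)) (s≤s (s≤s z≤n)) =
  subst (λ X → frac X 1 * recip (X ∸ 2) <ℚ (1ℚ * factor X) * factor w)
        (sym (ℕ.*-suc 3 (suc y))) (two-term-bound w (s≤s z≤n))
  where
  w = 3 *ℕ suc y

lemma4p8 : (x n : ℕ) → 1 ≤ x → 1 ≤ n →
    (prod n (λ k → 1ℚ + recip (3 *ℕ (x +ℕ k))) ≤ℚ 1ℚ + (+ n / 1) * recip (3 *ℕ x))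
    × (n ≤ x → 1ℚ + (+ n / 1) * recip (3 *ℕ x) ≤ℚ prod n (λ k → 1ℚ + recip (3 *ℕ (x ∸ k))))
    × (n ≤ x → 2 ≤ n → (+ (3 *ℕ x) / 1) * recip (3 *ℕ x ∸ n) <ℚ prod n (λ k → 1ℚ + recip (3 *ℕ (x ∸ k))))
lemma4p8 x@(suc _) n _ _ = rising , falling , sharp
  where
  X = 3 *ℕ x
  rising : prod n (λ k → factor (3 *ℕ (x +ℕ k))) ≤ℚ 1ℚ + frac n 1 * recip X
  rising = subst (prod n (λ k → factor (3 *ℕ (x +ℕ k))) ≤ℚ_) (sym (one-plus-multiple n X))
                 (product-upper-bound X (λ k → 3 *ℕ (x +ℕ k)) (rising-denominator x) n)
  falling : n ≤ x → 1ℚ + frac n 1 * recip X ≤ℚ prod n (λ k → factor (3 *ℕ (x ∸ k)))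
  falling n≤x = subst (_≤ℚ prod n (λ k → factor (3 *ℕ (x ∸ k)))) (sym (one-plus-multiple n X))
                  (product-lower-bound X (λ k → 3 *ℕ (x ∸ k)) x (falling-denominator-pos x)
                     (λ k _ → falling-denominator-≤ x k) n n≤x)
  sharp : n ≤ x → 2 ≤ n → frac X 1 * recip (X ∸ n) <ℚ prod n (λ k → factor (3 *ℕ (x ∸ k)))
  sharp n≤x 2≤n = reciprocal-lower-bound X X (λ k → 3 *ℕ (x ∸ k)) 2 x
    (two-factor-base x (ℕ.≤-trans 2≤n n≤x))
    (λ k _ k<x → falling-denominator-pos x k k<x)
    (λ k 2≤k _ → falling-denominator-gap x k (ℕ.≤-trans (s≤s z≤n) 2≤k))
    n 2≤n n≤x
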